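{- Let $n\ge1$ and let $G$ be a connected $\gamma_R$-excellent graph of order $n$ having the minimum number of edges among all connected $\gamma_R$-excellent graphs of order $n$. Then either $G=K_3$, or $n\neq3$ and $G$ is a tree.
   Context: A Roman dominating function (RDF) on a graph $G$ is a map $f:V(G)\to\{0,1,2\}$ such that every vertex $v$ with $f(v)=0$ has a neighbor $u$ with $f(u)=2$; its weight is $\sum_v f(v)$. $\gamma_R(G)$ is the minimum weight of an RDF on $G$; an RDF of that weight is a $\gamma_R$-function. $G$ is $\gamma_R$-excellent if every vertex $v$ has a $\gamma_R$-function $f$ with $f(v)\neq0$. -}

module Defs where

open import Data.Nat using (ℕ; zero; suc; _+_; _≤_; _∸_)
open import Data.Fin using (Fin; toℕ) renaming (_<?_ to _<ᶠ?_)
open import Data.Nat.ListAction using (sum)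
open import Data.List using (List; []; _∷_; map; allFin; length; head; last)
open import Data.List.Relation.Unary.Unique.Propositional using (Unique)
open import Data.List.Relation.Unary.Linked using (Linked)
open import Data.Maybe using (just)
open import Data.Bool using (Bool; true; false; if_then_else_; _∧_)
open import Data.Product using (Σ; ∃; ∃-syntax; _×_; _,_)
open import Relation.Nullary using (¬_)
open import Relation.Nullary.Decidable using (isYes)
open import Relation.Binary.PropositionalEquality using (_≡_; _≢_)
open import Relation.Binary.Construct.Closure.ReflexiveTransitive using (Star)

record Graph (n : ℕ) : Set where
  field
    adj   : Fin n → Fin n → Bool
    sym   : ∀ u v → adj u v ≡ adj v u
    irrefl : ∀ v → adj v v ≡ false

open Graph public

Adj : ∀ {n} → Graph n → Fin n → Fin n → Set
Adj G u v = adj G u v ≡ true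

edges : ∀ {n} → Graph n → ℕ
edges {n} G = sum (map (λ i → sum (map (λ j →
  if isYes (i <ᶠ? j) ∧ adj G i j then 1 else 0) (allFin n))) (allFin n))

Connected : ∀ {n} → Graph n → Set
Connected {n} G = ∀ (u v : Fin n) → Star (Adj G) u v

IsCycle : ∀ {n} → Graph n → List (Fin n) → Set
IsCycle G vs = 3 ≤ length vs × Unique vs × Linked (Adj G) vs
  × ∃[ a ] ∃[ b ] (head vs ≡ just a × last vs ≡ just b × Adj G b a)

Acyclic : ∀ {n} → Graph n → Set
Acyclic G = ∀ vs → ¬ IsCycle G vs

IsTree : ∀ {n} → Graph n → Set
IsTree G = Connected G × Acyclic G

IsK3 : ∀ {n} → Graph n → Set
IsK3 {n} G = n ≡ 3 × (∀ u v → u ≢ v → Adj G u v)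

weight : ∀ {n} → (Fin n → Fin 3) → ℕ
weight {n} f = sum (map (λ v → toℕ (f v)) (allFin n))

IsRDF : ∀ {n} → Graph n → (Fin n → Fin 3) → Set
IsRDF {n} G f = ∀ v → toℕ (f v) ≡ 0 → ∃[ u ] (Adj G v u × toℕ (f u) ≡ 2)

IsγRFunction : ∀ {n} → Graph n → (Fin n → Fin 3) → Set
IsγRFunction {n} G f = IsRDF G f × (∀ g → IsRDF G g → weight f ≤ weight g)

γR-Excellent : ∀ {n} → Graph n → Set
γR-Excellent {n} G = ∀ (v : Fin n) → ∃[ f ] (IsγRFunction G f × toℕ (f v) ≢ 0)

-- For n = 3: a connected graph on three vertices other than K₃ is a path u – w – v. Value 2 on w
-- alone is a Roman dominating function of weight 2, while one that is nonzero at the end u weighs at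
-- least 3, so the path is not γR-excellent.
-- For n ≠ 3 there is a γR-excellent tree on n vertices: K₁, K₂, P₄, P₅, and from P₃, P₄, P₅ every
-- larger order by repeatedly hanging a cherry K₁,₂ by its centre at a hub vertex. So a minimum G has
-- fewer than n edges. But a connected graph with a cycle has at least n: deleting a cycle edge ac keeps
-- it connected, and breadth-first search towards a in what remains gives every v ≠ a its own edge to a
-- parent closer to a, while a keeps ac. Hence G is a tree.

module Submission where

open import Defs hiding (sym)
open import Data.Nat using (ℕ; zero; suc; _+_; _≤_; _<_; z≤n; s≤s; _≡ᵇ_) renaming (_≟_ to _≟ℕ_)
open import Data.Nat.Properties
open import Data.Nat.ListAction using (sum)
open import Data.Nat.Tactic.RingSolver using (solve-∀)
open import Data.Fin using (Fin; zero; suc; toℕ) renaming (_<_ to _<ᶠ_; _<?_ to _<ᶠ?_; _≟_ to _≟ᶠ_)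
open import Data.Fin.Patterns using (0F; 1F; 2F; 3F; 4F)
open import Data.Fin.Properties using (injective⇒≤; toℕ-injective; any?)
open import Data.List using (List; []; _∷_; map; allFin; length; lookup; concatMap; filterᵇ; last)
open import Data.List.Properties using (map-tabulate; map-cong; length-map; length-++)
open import Data.List.Membership.Propositional using (_∈_)
open import Data.List.Membership.Propositional.Properties using (∈-allFin; ∈-map⁺; ∈-filter⁺; ∈-concat⁺′)
open import Data.List.Relation.Unary.Any using (index; here; there)
open import Data.List.Relation.Unary.Any.Properties using (lookup-index)
open import Data.List.Relation.Unary.All using (All; _∷_)
import Data.List.Relation.Unary.All as All
open import Data.List.Relation.Unary.AllPairs using (_∷_)
open import Data.List.Relation.Unary.Linked using (Linked; _∷_)
open import Data.Maybe using (just)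
open import Data.Vec.Functional using () renaming (_∷_ to _∷ᵥ_)
open import Data.Bool using (Bool; true; false; T; T?; if_then_else_; _∧_; _∨_) renaming (_≟_ to _≟ᵇ_)
open import Data.Bool.Properties using (∨-comm; ∨-idem)
open import Data.Product using (∃; ∃-syntax; _×_; _,_; proj₁; proj₂)
open import Data.Sum using (_⊎_; inj₁; inj₂; swap)
open import Data.Unit using (tt)
open import Function using (_∘_)
open import Relation.Nullary using (¬_; ¬?; Dec; yes; no; contradiction)
open import Relation.Nullary.Decidable using (isYes; isYes≗does; dec-true; decidable-stable; _⊎-dec_; _×-dec_)
open import Relation.Binary.PropositionalEquality
open import Relation.Binary.Construct.Closure.ReflexiveTransitive using (Star; ε; _◅_; _◅◅_; gmap; reverse; _⋆)

∑ : ∀ {n} → (Fin n → ℕ) → ℕ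
∑ {n} h = sum (map h (allFin n))

∑-suc : ∀ {n} (h : Fin (suc n) → ℕ) → ∑ h ≡ h zero + ∑ (h ∘ suc)
∑-suc h = cong (h zero +_) (cong sum (trans (map-tabulate suc h) (sym (map-tabulate (λ i → i) (h ∘ suc)))))

∑-cong : ∀ {n} {h k : Fin n → ℕ} → (∀ i → h i ≡ k i) → ∑ h ≡ ∑ k
∑-cong {n} h≗k = cong sum (map-cong h≗k (allFin n))

∑-zero : ∀ {n} (h : Fin n → ℕ) → (∀ i → h i ≡ 0) → ∑ h ≡ 0
∑-zero {zero} h _ = refl
∑-zero {suc n} h h≗0 = trans (∑-suc h) (cong₂ _+_ (h≗0 zero) (∑-zero (h ∘ suc) (h≗0 ∘ suc)))

lift : ∀ {n} → Fin n → Fin (3 + n)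
lift i = suc (suc (suc i))

∑-split₃ : ∀ {n} (h : Fin (3 + n) → ℕ) → ∑ h ≡ h 0F + h 1F + h 2F + ∑ (h ∘ lift)
∑-split₃ h = begin
  ∑ h                                               ≡⟨ ∑-suc h ⟩
  h 0F + ∑ (λ i → h (suc i))                        ≡⟨ cong (h 0F +_) (∑-suc (λ i → h (suc i))) ⟩
  h 0F + (h 1F + ∑ (λ i → h (suc (suc i))))
    ≡⟨ cong (λ x → h 0F + (h 1F + x)) (∑-suc (λ i → h (suc (suc i)))) ⟩
  h 0F + (h 1F + (h 2F + ∑ (h ∘ lift)))             ≡⟨ reassociate (h 0F) (h 1F) (h 2F) _ ⟩
  h 0F + h 1F + h 2F + ∑ (h ∘ lift)                 ∎
  where
  open ≡-Reasoning
  reassociate : ∀ a b c d → a + (b + (c + d)) ≡ a + b + c + d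
  reassociate = solve-∀

weight-split₃ : ∀ {n} (f : Fin (3 + n) → Fin 3) →
  weight f ≡ toℕ (f 0F) + toℕ (f 1F) + toℕ (f 2F) + weight (f ∘ lift)
weight-split₃ f = ∑-split₃ (toℕ ∘ f)

-- Counting edges

SameEdge : ∀ {n} → Fin n × Fin n → Fin n × Fin n → Set
SameEdge (u , v) (u' , v') = (u ≡ u' × v ≡ v') ⊎ (u ≡ v' × v ≡ u')

forward : ∀ {n} → Graph n → Fin n → Fin n → Bool
forward G i j = isYes (i <ᶠ? j) ∧ adj G i j

edgeRow : ∀ {n} → Graph n → Fin n → List (Fin n × Fin n)
edgeRow {n} G i = map (i ,_) (filterᵇ (forward G i) (allFin n))

edgeList : ∀ {n} → Graph n → List (Fin n × Fin n)
edgeList {n} G = concatMap (edgeRow G) (allFin n)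

sum-indicator : ∀ {A : Set} (p : A → Bool) xs →
  sum (map (λ x → if p x then 1 else 0) xs) ≡ length (filterᵇ p xs)
sum-indicator p [] = refl
sum-indicator p (x ∷ xs) with p x
... | true  = cong suc (sum-indicator p xs)
... | false = sum-indicator p xs

length-concatMap : ∀ {A B : Set} (f : A → List B) xs → length (concatMap f xs) ≡ sum (map (length ∘ f) xs)
length-concatMap f [] = refl
length-concatMap f (x ∷ xs) = trans (length-++ (f x)) (cong (length (f x) +_) (length-concatMap f xs))

edges≡length-edgeList : ∀ {n} (G : Graph n) → edges G ≡ length (edgeList G)
edges≡length-edgeList {n} G = begin
  edges G                                              ≡⟨ ∑-cong (λ i → sum-indicator (forward G i) (allFin n)) ⟩
  ∑ (λ i → length (filterᵇ (forward G i) (allFin n)))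
    ≡⟨ ∑-cong (λ i → length-map (i ,_) (filterᵇ (forward G i) (allFin n))) ⟨
  ∑ (length ∘ edgeRow G)                               ≡⟨ length-concatMap (edgeRow G) (allFin n) ⟨
  length (edgeList G)                                  ∎
  where open ≡-Reasoning

adj-sym : ∀ {n} (G : Graph n) {u v} → Adj G u v → Adj G v u
adj-sym G {u} {v} uv = trans (Graph.sym G v u) uv

adj-≢ : ∀ {n} (G : Graph n) {u v} → Adj G u v → u ≢ v
adj-≢ G {u} uu refl = contradiction (trans (sym uu) (irrefl G u)) λ ()

∈-edgeList : ∀ {n} (G : Graph n) {u v} → u <ᶠ v → Adj G u v → (u , v) ∈ edgeList G
∈-edgeList {n} G {u} {v} u<v uv =
  ∈-concat⁺′ (∈-map⁺ (u ,_) (∈-filter⁺ (T? ∘ forward G u) (∈-allFin v) forward-uv))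
             (∈-map⁺ (edgeRow G) (∈-allFin u))
  where
  forward-uv : T (forward G u v)
  forward-uv rewrite isYes≗does (u <ᶠ? v) | dec-true (u <ᶠ? v) u<v | uv = tt

orient : ∀ {n} → Fin n × Fin n → Fin n × Fin n
orient (u , v) with u <ᶠ? v
... | yes _ = (u , v)
... | no  _ = (v , u)

orient-∈-edgeList : ∀ {n} (G : Graph n) {u v} → Adj G u v → orient (u , v) ∈ edgeList G
orient-∈-edgeList G {u} {v} uv with u <ᶠ? v
... | yes u<v = ∈-edgeList G u<v uv
... | no  u≮v = ∈-edgeList G (≤∧≢⇒< (≮⇒≥ u≮v) (adj-≢ G uv ∘ sym ∘ toℕ-injective)) (adj-sym G uv)

orient-injective : ∀ {n} (p q : Fin n × Fin n) → orient p ≡ orient q → SameEdge p q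
orient-injective (u , v) (u' , v') eq with u <ᶠ? v | u' <ᶠ? v'
... | yes _ | yes _ = inj₁ (cong proj₁ eq , cong proj₂ eq)
... | yes _ | no  _ = inj₂ (cong proj₁ eq , cong proj₂ eq)
... | no  _ | yes _ = inj₂ (cong proj₂ eq , cong proj₁ eq)
... | no  _ | no  _ = inj₁ (cong proj₂ eq , cong proj₁ eq)

injective⇒≤length : ∀ {n} {A : Set} {xs : List A} (f : Fin n → A) →
  (∀ {i j} → f i ≡ f j → i ≡ j) → (∀ i → f i ∈ xs) → n ≤ length xs
injective⇒≤length {xs = xs} f f-inj f∈xs = injective⇒≤ {f = index ∘ f∈xs} λ {i} {j} eq →
  f-inj (trans (lookup-index (f∈xs i)) (trans (cong (lookup xs) eq) (sym (lookup-index (f∈xs j)))))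

edge-assignment⇒≤edges : ∀ {n} (G : Graph n) (e : Fin n → Fin n × Fin n) →
  (∀ v → Adj G (proj₁ (e v)) (proj₂ (e v))) → (∀ {v w} → SameEdge (e v) (e w) → v ≡ w) → n ≤ edges G
edge-assignment⇒≤edges G e e-edge e-inj rewrite edges≡length-edgeList G =
  injective⇒≤length (orient ∘ e) (λ {v} {w} → e-inj ∘ orient-injective (e v) (e w))
                    (λ v → orient-∈-edgeList G (e-edge v))

-- Cycles

module _ {P : ℕ → Set} (P? : ∀ k → Dec (P k)) where

  private
    search : ∀ m → (∃ λ k → P k × (∀ {j} → j < k → ¬ P j)) ⊎ (∀ {j} → j < m → ¬ P j)
    search zero = inj₂ λ ()
    search (suc m) with search m
    ... | inj₁ least = inj₁ least
    ... | inj₂ none-below with P? m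
    ...   | yes pm = inj₁ (m , pm , none-below)
    ...   | no ¬pm = inj₂ λ {j} j<1+m → case (m<1+n⇒m<n∨m≡n j<1+m)
      where
      case : ∀ {j} → j < m ⊎ j ≡ m → ¬ P j
      case (inj₁ j<m) = none-below j<m
      case (inj₂ refl) = ¬pm

  least-witness : ∀ {m} → P m → ∃ λ k → P k × (∀ {j} → j < k → ¬ P j)
  least-witness {m} pm with search (suc m)
  ... | inj₁ least = least
  ... | inj₂ none-below = contradiction pm (none-below ≤-refl)

module _ {n} {R : Fin n → Fin n → Set} (R? : ∀ u v → Dec (R u v)) {r : Fin n} where

  private
    Within : ℕ → Fin n → Set
    Within zero v = v ≡ r
    Within (suc k) v = Within k v ⊎ ∃ λ u → R v u × Within k u

    within? : ∀ k v → Dec (Within k v)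
    within? zero v = v ≟ᶠ r
    within? (suc k) v = within? k v ⊎-dec any? (λ u → R? v u ×-dec within? k u)

    walk⇒within : ∀ {v} → Star R v r → ∃ λ k → Within k v
    walk⇒within ε = 0 , refl
    walk⇒within (step ◅ walk) with walk⇒within walk
    ... | k , near = suc k , inj₂ (_ , step , near)

  descending-potential : (∀ v → Star R v r) →
    ∃ λ (d : Fin n → ℕ) → ∀ v → v ≢ r → ∃ λ u → R v u × d u < d v
  descending-potential walk = d , descend
    where
    distance : ∀ v → ∃ λ k → Within k v × (∀ {j} → j < k → ¬ Within j v)
    distance v = least-witness (λ k → within? k v) (proj₂ (walk⇒within (walk v)))

    d : Fin n → ℕ
    d = proj₁ ∘ distance

    descend : ∀ v → v ≢ r → ∃ λ u → R v u × d u < d v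
    descend v v≢r with distance v
    ... | zero , v≡r , _ = contradiction v≡r v≢r
    ... | suc k , inj₁ near , least = contradiction near (least ≤-refl)
    ... | suc k , inj₂ (u , vu , near) , _ =
      u , vu , s≤s (≮⇒≥ λ k<du → proj₂ (proj₂ (distance u)) k<du near)

AdjWithout : ∀ {n} → Graph n → Fin n × Fin n → Fin n → Fin n → Set
AdjWithout G e u v = Adj G u v × ¬ SameEdge (u , v) e

sameEdge? : ∀ {n} (p q : Fin n × Fin n) → Dec (SameEdge p q)
sameEdge? (u , v) (u' , v') = ((u ≟ᶠ u') ×-dec (v ≟ᶠ v')) ⊎-dec ((u ≟ᶠ v') ×-dec (v ≟ᶠ u'))

sameEdge-swap : ∀ {n} {u v : Fin n} {e} → SameEdge (u , v) e → SameEdge (v , u) e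
sameEdge-swap (inj₁ (u≡ , v≡)) = inj₂ (v≡ , u≡)
sameEdge-swap (inj₂ (u≡ , v≡)) = inj₁ (v≡ , u≡)

sameEdge-sym : ∀ {n} {p q : Fin n × Fin n} → SameEdge p q → SameEdge q p
sameEdge-sym (inj₁ (≡₁ , ≡₂)) = inj₁ (sym ≡₁ , sym ≡₂)
sameEdge-sym (inj₂ (≡₁ , ≡₂)) = inj₂ (sym ≡₂ , sym ≡₁)

nonBridge⇒≤edges : ∀ {n} (G : Graph n) → Connected G → ∀ {a c} → Adj G a c →
  Star (AdjWithout G (a , c)) c a → n ≤ edges G
nonBridge⇒≤edges {n} G conn {a} {c} ac ca = edge-assignment⇒≤edges G e e-edge e-inj
  where
  R = AdjWithout G (a , c)

  R-sym : ∀ {u v} → R u v → R v u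
  R-sym (uv , ¬same) = adj-sym G uv , ¬same ∘ sameEdge-swap

  bypass : ∀ {u v} → Adj G u v → Star R u v
  bypass {u} {v} uv with sameEdge? (u , v) (a , c)
  ... | no ¬same = (uv , ¬same) ◅ ε
  ... | yes (inj₁ (refl , refl)) = reverse R-sym ca
  ... | yes (inj₂ (refl , refl)) = ca

  potential = descending-potential (λ u v → (adj G u v ≟ᵇ true) ×-dec ¬? (sameEdge? (u , v) (a , c)))
                                   (λ v → (bypass ⋆) (conn v a))
  d = proj₁ potential
  parent = proj₂ potential

  e : Fin n → Fin n × Fin n
  e v with v ≟ᶠ a
  ... | yes _ = (a , c)
  ... | no v≢a = (v , proj₁ (parent v v≢a))

  e-edge : ∀ v → Adj G (proj₁ (e v)) (proj₂ (e v))
  e-edge v with v ≟ᶠ a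
  ... | yes _ = ac
  ... | no v≢a = proj₁ (proj₁ (proj₂ (parent v v≢a)))

  -- The edge chosen for v ≢ a is never {a, c}, since parents are taken with that edge deleted.
  e-inj : ∀ {v w} → SameEdge (e v) (e w) → v ≡ w
  e-inj {v} {w} same with v ≟ᶠ a | w ≟ᶠ a
  ... | yes refl | yes refl = refl
  ... | yes refl | no w≢a = contradiction (sameEdge-sym same) (proj₂ (proj₁ (proj₂ (parent w w≢a))))
  ... | no v≢a | yes refl = contradiction same (proj₂ (proj₁ (proj₂ (parent v v≢a))))
  ... | no v≢a | no w≢a with same
  ...   | inj₁ (v≡w , _) = v≡w
  ...   | inj₂ (v≡pw , pv≡w) = contradiction (descends v≢a pv≡w) (<-asym (descends w≢a (sym v≡pw)))
    where
    descends : ∀ {x y} (x≢a : x ≢ a) → proj₁ (parent x x≢a) ≡ y → d y < d x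
    descends {x} x≢a refl = proj₂ (proj₂ (parent x x≢a))

last-∈ : ∀ {A : Set} {b : A} xs → last xs ≡ just b → b ∈ xs
last-∈ (x ∷ []) refl = here refl
last-∈ (x ∷ y ∷ ys) eq = there (last-∈ (y ∷ ys) eq)

avoiding⇒walkWithout : ∀ {n} (G : Graph n) {a c x b} xs → Linked (Adj G) (x ∷ xs) → All (a ≢_) (x ∷ xs) →
  last (x ∷ xs) ≡ just b → Star (AdjWithout G (a , c)) x b
avoiding⇒walkWithout G [] _ _ refl = ε
avoiding⇒walkWithout G {a} (y ∷ ys) (xy ∷ linked) (a≢x ∷ a∉) eq =
  (xy , avoid) ◅ avoiding⇒walkWithout G ys linked a∉ eq
  where
  avoid : ¬ SameEdge _ (a , _)
  avoid (inj₁ (x≡a , _)) = a≢x (sym x≡a)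
  avoid (inj₂ (_ , y≡a)) = All.head a∉ (sym y≡a)

cycle⇒≤edges : ∀ {n} (G : Graph n) → Connected G → ∀ vs → IsCycle G vs → n ≤ edges G
cycle⇒≤edges G conn [] (() , _)
cycle⇒≤edges G conn (_ ∷ []) (s≤s () , _)
cycle⇒≤edges G conn (_ ∷ _ ∷ []) (s≤s (s≤s ()) , _)
cycle⇒≤edges G conn (a ∷ c ∷ d ∷ ws) (_ , (a∉ ∷ c∉ ∷ _) , (ac ∷ linked) , _ , b , refl , last≡b , ba) =
  nonBridge⇒≤edges G conn ac (avoiding⇒walkWithout G (d ∷ ws) linked a∉ last≡b ◅◅ ((ba , avoid) ◅ ε))
  where
  b∈ = last-∈ (d ∷ ws) last≡b
  avoid : ¬ SameEdge (b , a) (a , c)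
  avoid (inj₁ (b≡a , _)) = All.lookup (All.tail a∉) b∈ (sym b≡a)
  avoid (inj₂ (b≡c , _)) = All.lookup c∉ b∈ (sym b≡c)

-- Roman domination

Dominated : ∀ {n} → Graph n → (Fin n → Fin 3) → Fin n → Set
Dominated G f v = toℕ (f v) ≡ 0 → ∃[ u ] (Adj G v u × toℕ (f u) ≡ 2)

IsRDFExcept : ∀ {n} → Graph n → Fin n → (Fin n → Fin 3) → Set
IsRDFExcept G h f = ∀ v → v ≢ h → Dominated G f v

rdf⇒rdfExcept : ∀ {n} {G : Graph n} {h f} → IsRDF G f → IsRDFExcept G h f
rdf⇒rdfExcept rdf v _ = rdf v

sole-neighbour-two : ∀ {n} (G : Graph n) {f v y} → (∀ {u} → Adj G v u → u ≡ y) →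
  Dominated G f v → toℕ (f v) ≡ 0 → toℕ (f y) ≡ 2
sole-neighbour-two G only dom fv≡0 with dom fv≡0
... | u , vu , two rewrite only vu = two

one-of-neighbours-two : ∀ {n} (G : Graph n) {f v x y} → (∀ {u} → Adj G v u → u ≡ x ⊎ u ≡ y) →
  Dominated G f v → toℕ (f v) ≡ 0 → toℕ (f x) ≡ 2 ⊎ toℕ (f y) ≡ 2
one-of-neighbours-two G only dom fv≡0 with dom fv≡0
... | u , vu , two with only vu
...   | inj₁ refl = inj₁ two
...   | inj₂ refl = inj₂ two

-- A vertex of value 2 can pay for both legs hanging from it: each leg may borrow δ₂ = 1 from it.
δ₂ : Fin 3 → ℕ
δ₂ 2F = 1
δ₂ _ = 0

δ₂-double : ∀ h → δ₂ h + δ₂ h ≤ toℕ h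
δ₂-double 0F = z≤n
δ₂-double 1F = z≤n
δ₂-double 2F = ≤-refl

δ₂-nonzero : ∀ h → toℕ h ≢ 0 → suc (δ₂ h) ≤ toℕ h
δ₂-nonzero 0F h≢0 = contradiction refl h≢0
δ₂-nonzero 1F _ = ≤-refl
δ₂-nonzero 2F _ = ≤-refl

leaf-bound : ∀ (x h : Fin 3) → (toℕ x ≡ 0 → toℕ h ≡ 2) → 1 ≤ toℕ x + δ₂ h
leaf-bound 0F 2F _ = ≤-refl
leaf-bound 0F 0F dom with () ← dom refl
leaf-bound 0F 1F dom with () ← dom refl
leaf-bound (suc x) h _ = s≤s z≤n

pendant-pair-bound : ∀ (x y h : Fin 3) → (toℕ x ≡ 0 → toℕ y ≡ 2) →
  (toℕ y ≡ 0 → toℕ x ≡ 2 ⊎ toℕ h ≡ 2) → 2 ≤ toℕ x + toℕ y + δ₂ h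
pendant-pair-bound 0F 2F h _ _ = s≤s (s≤s z≤n)
pendant-pair-bound 0F 0F h dom _ with () ← dom refl
pendant-pair-bound 0F 1F h dom _ with () ← dom refl
pendant-pair-bound 1F 1F h _ _ = s≤s (s≤s z≤n)
pendant-pair-bound 1F 2F h _ _ = s≤s (s≤s z≤n)
pendant-pair-bound 1F 0F 2F _ _ = ≤-refl
pendant-pair-bound 1F 0F 0F _ dom with dom refl
... | inj₁ ()
... | inj₂ ()
pendant-pair-bound 1F 0F 1F _ dom with dom refl
... | inj₁ ()
... | inj₂ ()
pendant-pair-bound 2F y h _ _ = s≤s (s≤s z≤n)

pendant-pair-at-nonzero-bound : ∀ (x y h : Fin 3) → toℕ h ≢ 0 → (toℕ x ≡ 0 → toℕ y ≡ 2) →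
  (toℕ y ≡ 0 → toℕ x ≡ 2 ⊎ toℕ h ≡ 2) → 3 ≤ toℕ h + toℕ x + toℕ y
pendant-pair-at-nonzero-bound x y h h≢0 dom-x dom-y = begin
  3                                 ≤⟨ +-monoˡ-≤ 1 (pendant-pair-bound x y h dom-x dom-y) ⟩
  toℕ x + toℕ y + δ₂ h + 1          ≡⟨ shuffle (toℕ x) (toℕ y) (δ₂ h) ⟩
  suc (δ₂ h) + (toℕ x + toℕ y)      ≤⟨ +-monoˡ-≤ (toℕ x + toℕ y) (δ₂-nonzero h h≢0) ⟩
  toℕ h + (toℕ x + toℕ y)           ≡⟨ +-assoc (toℕ h) (toℕ x) (toℕ y) ⟨
  toℕ h + toℕ x + toℕ y             ∎
  where
  open ≤-Reasoning
  shuffle : ∀ a b c → a + b + c + 1 ≡ suc c + (a + b)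
  shuffle = solve-∀

legs-bound : ∀ {l₁ l₂ L₁ L₂} h → l₁ ≤ L₁ + δ₂ h → l₂ ≤ L₂ + δ₂ h →
  l₁ + l₂ ≤ L₁ + L₂ + toℕ h
legs-bound {l₁} {l₂} {L₁} {L₂} h leg₁ leg₂ = begin
  l₁ + l₂                    ≤⟨ +-mono-≤ leg₁ leg₂ ⟩
  L₁ + δ₂ h + (L₂ + δ₂ h)    ≡⟨ shuffle L₁ L₂ (δ₂ h) ⟩
  L₁ + L₂ + (δ₂ h + δ₂ h)    ≤⟨ +-monoʳ-≤ (L₁ + L₂) (δ₂-double h) ⟩
  L₁ + L₂ + toℕ h            ∎
  where
  open ≤-Reasoning
  shuffle : ∀ a b c → a + c + (b + c) ≡ a + b + (c + c)
  shuffle = solve-∀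

ExcellenceWitness : ∀ {n} → Graph n → ℕ → Fin n → Set
ExcellenceWitness G w v = ∃[ f ] (IsRDF G f × toℕ (f v) ≢ 0 × weight f ≤ w)

excellent-from-witnesses : ∀ {n} (G : Graph n) {w} → (∀ f → IsRDF G f → w ≤ weight f) →
  (∀ v → ExcellenceWitness G w v) → γR-Excellent G
excellent-from-witnesses G lower witness v with witness v
... | f , rdf , fv≢0 , f≤w = f , (rdf , λ g g-rdf → ≤-trans f≤w (lower g g-rdf)) , fv≢0

symmetricGraph : ∀ {n} (e : Fin n → Fin n → Bool) → (∀ v → e v v ≡ false) → Graph n
symmetricGraph e e-irrefl = record
  { adj = λ u v → e u v ∨ e v u
  ; sym = λ u v → ∨-comm (e u v) (e v u)
  ; irrefl = λ v → cong₂ _∨_ (e-irrefl v) (e-irrefl v)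
  }

1+n≢ᵇn : ∀ n → (suc n ≡ᵇ n) ≡ false
1+n≢ᵇn zero = refl
1+n≢ᵇn (suc n) = 1+n≢ᵇn n

pathGraph : ∀ n → Graph n
pathGraph n = symmetricGraph (λ i j → suc (toℕ i) ≡ᵇ toℕ j) (1+n≢ᵇn ∘ toℕ)

cherry : Graph 3
cherry = symmetricGraph edge λ { 0F → refl ; 1F → refl ; 2F → refl }
  where
  edge : Fin 3 → Fin 3 → Bool
  edge 0F 2F = true
  edge 1F 2F = true
  edge _ _ = false

-- Hanging a cherry at the hub

hub : ∀ {m} → Fin (3 + m)
hub = 2F

-- Hanging a cherry at the hub preserves this invariant, with w + 2, and makes the graph γR-excellent:
-- the new centre may take value 2 and dominate the old hub, which is why the hub is exempt here.
record HubExcellent {m} (H : Graph (3 + m)) (w : ℕ) : Set where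
  field
    lower-bound : ∀ f → IsRDFExcept H hub f → w ≤ weight f
    hub-two : ∃[ f ] (IsRDF H f × toℕ (f hub) ≡ 2 × weight f ≤ w)
    witness : ∀ v → ∃[ f ] (IsRDFExcept H hub f × toℕ (f v) ≢ 0 × weight f ≤ w)

isHub : ∀ {m} → Fin (3 + m) → Bool
isHub 2F = true
isHub _ = false

isHub⇒≡hub : ∀ {m} {i : Fin (3 + m)} → isHub i ≡ true → i ≡ hub
isHub⇒≡hub {i = 2F} _ = refl

relax : ∀ {m} {G : Graph (3 + m)} {w v} → ExcellenceWitness G w v →
  ∃[ f ] (IsRDFExcept G hub f × toℕ (f v) ≢ 0 × weight f ≤ w)
relax {G = G} (f , rdf , fv≢0 , f≤w) = f , rdf⇒rdfExcept {G = G} rdf , fv≢0 , f≤w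

cherry-bound : ∀ {m} (G : Graph (3 + m)) → (∀ {u} → Adj G 0F u → u ≡ 2F) → (∀ {u} → Adj G 1F u → u ≡ 2F) →
  ∀ f → IsRDFExcept G hub f → 2 ≤ toℕ (f 0F) + toℕ (f 1F) + toℕ (f 2F)
cherry-bound G leaf₀ leaf₁ f rdf = legs-bound (f 2F)
  (leaf-bound (f 0F) (f 2F) (sole-neighbour-two G leaf₀ (rdf 0F λ ())))
  (leaf-bound (f 1F) (f 2F) (sole-neighbour-two G leaf₁ (rdf 1F λ ())))

-- Vertices 0 and 1 are the leaves of the cherry, 2 its centre (the new hub), and vertex 3 + i is vertex i of H.
addCherry : ∀ {m} → Graph (3 + m) → Graph (3 + (3 + m))
addCherry {m} H = symmetricGraph edge edge-irrefl
  where
  edge : Fin (3 + (3 + m)) → Fin (3 + (3 + m)) → Bool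
  edge (suc (suc (suc i))) (suc (suc (suc j))) = adj H i j
  edge 2F (suc (suc (suc k))) = isHub k
  edge 0F 2F = true
  edge 1F 2F = true
  edge _ _ = false

  edge-irrefl : ∀ v → edge v v ≡ false
  edge-irrefl 0F = refl
  edge-irrefl 1F = refl
  edge-irrefl 2F = refl
  edge-irrefl (suc (suc (suc i))) = irrefl H i

module _ {m} {H : Graph (3 + m)} where

  private
    X = addCherry H

  adj-symmetrised : ∀ i j → adj H i j ∨ adj H j i ≡ adj H i j
  adj-symmetrised i j = trans (cong (adj H i j ∨_) (Graph.sym H j i)) (∨-idem (adj H i j))

  addCherry-adj⁺ : ∀ {i j} → Adj H i j → Adj X (lift i) (lift j)
  addCherry-adj⁺ {i} {j} ij = cong (_∨ adj H j i) ij

  addCherry-adj⁻ : ∀ {i j} → Adj X (lift i) (lift j) → Adj H i j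
  addCherry-adj⁻ {i} {j} ij = trans (sym (adj-symmetrised i j)) ij

  addCherry-leaf₀ : ∀ {u} → Adj X 0F u → u ≡ 2F
  addCherry-leaf₀ {2F} _ = refl

  addCherry-leaf₁ : ∀ {u} → Adj X 1F u → u ≡ 2F
  addCherry-leaf₁ {2F} _ = refl

  addCherry-restrict : ∀ {f} → IsRDFExcept X hub f → IsRDFExcept H hub (f ∘ lift)
  addCherry-restrict rdf i i≢hub fi≡0 with rdf (lift i) (λ ()) fi≡0
  ... | 2F , i~2 , two = contradiction (isHub⇒≡hub i~2) i≢hub
  ... | suc (suc (suc u)) , iu , two = u , addCherry-adj⁻ iu , two

  addCherry-lower-bound : ∀ {w} → HubExcellent H w → ∀ f → IsRDFExcept X hub f → 2 + w ≤ weight f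
  addCherry-lower-bound {w} H-exc f rdf = begin
    2 + w                                                      ≤⟨ +-mono-≤ cherry-part old-part ⟩
    toℕ (f 0F) + toℕ (f 1F) + toℕ (f 2F) + weight (f ∘ lift)   ≡⟨ weight-split₃ f ⟨
    weight f                                                   ∎
    where
    open ≤-Reasoning
    cherry-part = cherry-bound X addCherry-leaf₀ addCherry-leaf₁ f rdf
    old-part = HubExcellent.lower-bound H-exc (f ∘ lift) (addCherry-restrict rdf)

  centre-two : ∀ {g} → IsRDFExcept H hub g → IsRDF X (0F ∷ᵥ 0F ∷ᵥ 2F ∷ᵥ g)
  centre-two rdf 0F _ = 2F , refl , refl
  centre-two rdf 1F _ = 2F , refl , refl
  centre-two rdf (suc (suc (suc i))) gi≡0 with i ≟ᶠ hub
  ... | yes refl = 2F , refl , refl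
  ... | no i≢hub with rdf i i≢hub gi≡0
  ...   | u , iu , two = lift u , addCherry-adj⁺ iu , two

  leaves-one : ∀ {d} → IsRDF H d → toℕ (d hub) ≡ 2 → IsRDF X (1F ∷ᵥ 1F ∷ᵥ 0F ∷ᵥ d)
  leaves-one rdf dhub≡2 2F _ = lift hub , refl , dhub≡2
  leaves-one rdf dhub≡2 (suc (suc (suc i))) di≡0 with rdf i di≡0
  ... | u , iu , two = lift u , addCherry-adj⁺ iu , two

  cherry-weight : ∀ a b c (g : Fin (3 + m) → Fin 3) {w} → weight g ≤ w →
    weight (a ∷ᵥ b ∷ᵥ c ∷ᵥ g) ≤ toℕ a + toℕ b + toℕ c + w
  cherry-weight a b c g g≤w =
    ≤-trans (≤-reflexive (weight-split₃ (a ∷ᵥ b ∷ᵥ c ∷ᵥ g))) (+-monoʳ-≤ _ g≤w)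

  addCherry-witness : ∀ {w} → HubExcellent H w → ∀ v → ExcellenceWitness X (2 + w) v
  addCherry-witness {w} H-exc with HubExcellent.hub-two H-exc
  ... | d , d-rdf , dhub≡2 , d≤w = witness
    where
    witness : ∀ v → ExcellenceWitness X (2 + w) v
    witness 0F = _ , leaves-one d-rdf dhub≡2 , (λ ()) , cherry-weight 1F 1F 0F d d≤w
    witness 1F = _ , leaves-one d-rdf dhub≡2 , (λ ()) , cherry-weight 1F 1F 0F d d≤w
    witness 2F = _ , centre-two (rdf⇒rdfExcept {G = H} d-rdf) , (λ ()) , cherry-weight 0F 0F 2F d d≤w
    witness (suc (suc (suc i))) with HubExcellent.witness H-exc i
    ... | g , g-rdf , gi≢0 , g≤w = _ , centre-two g-rdf , gi≢0 , cherry-weight 0F 0F 2F g g≤w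

  addCherry-hubExcellent : ∀ {w} → HubExcellent H w → HubExcellent X (2 + w)
  addCherry-hubExcellent H-exc with HubExcellent.hub-two H-exc
  ... | d , d-rdf , _ , d≤w = record
    { lower-bound = addCherry-lower-bound H-exc
    ; hub-two = _ , centre-two (rdf⇒rdfExcept {G = H} d-rdf) , refl , cherry-weight 0F 0F 2F d d≤w
    ; witness = relax {G = X} ∘ addCherry-witness H-exc
    }

  addCherry-excellent : ∀ {w} → HubExcellent H w → γR-Excellent X
  addCherry-excellent H-exc = excellent-from-witnesses X
    (λ f rdf → addCherry-lower-bound H-exc f (rdf⇒rdfExcept {G = X} rdf)) (addCherry-witness H-exc)

  addCherry-reaches-hub : (∀ v → Star (Adj H) v hub) → ∀ v → Star (Adj X) v hub
  addCherry-reaches-hub reach 0F = refl ◅ ε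
  addCherry-reaches-hub reach 1F = refl ◅ ε
  addCherry-reaches-hub reach 2F = ε
  addCherry-reaches-hub reach (suc (suc (suc i))) = gmap lift addCherry-adj⁺ (reach i) ◅◅ (refl ◅ ε)

row : ∀ {n} → Graph n → Fin n → ℕ
row G i = ∑ (λ j → if forward G i j then 1 else 0)

isYes-lift< : ∀ {n} (i j : Fin n) → isYes (lift i <ᶠ? lift j) ≡ isYes (i <ᶠ? j)
isYes-lift< i j = trans (isYes≗does (lift i <ᶠ? lift j)) (sym (isYes≗does (i <ᶠ? j)))

addCherry-edges : ∀ {m} (H : Graph (3 + m)) → edges (addCherry H) ≡ 3 + edges H
addCherry-edges {m} H = begin
  edges X                                               ≡⟨ ∑-split₃ (row X) ⟩
  row X 0F + row X 1F + row X 2F + ∑ (row X ∘ lift)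
    ≡⟨ cong₂ _+_ (cong₂ _+_ (cong₂ _+_ row₀ row₁) row₂) (∑-cong old-row) ⟩
  3 + edges H                                           ∎
  where
  open ≡-Reasoning
  X = addCherry H
  entry : Fin (3 + (3 + m)) → Fin (3 + (3 + m)) → ℕ
  entry i j = if forward X i j then 1 else 0
  row₀ : row X 0F ≡ 1
  row₀ = trans (∑-split₃ (entry 0F)) (cong suc (∑-zero {3 + m} _ λ _ → refl))
  row₁ : row X 1F ≡ 1
  row₁ = trans (∑-split₃ (entry 1F)) (cong suc (∑-zero {3 + m} _ λ _ → refl))
  row₂ : row X 2F ≡ 1
  row₂ = trans (∑-split₃ (entry 2F))
    (trans (∑-split₃ (λ (k : Fin (3 + m)) → if isHub k ∨ false then 1 else 0))
           (cong suc (∑-zero {m} _ λ _ → refl)))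
  old-row : ∀ i → row X (lift i) ≡ row H i
  old-row i = trans (∑-split₃ (entry (lift i))) (∑-cong λ j → cong (λ b → if b then 1 else 0)
    (cong₂ _∧_ (isYes-lift< i j) (adj-symmetrised {H = H} i j)))

cherry-hubExcellent : HubExcellent cherry 2
cherry-hubExcellent = record
  { lower-bound = λ f rdf →
      ≤-trans (cherry-bound cherry leaf₀ leaf₁ f rdf) (≤-reflexive (sym (trans (weight-split₃ f) (+-identityʳ _))))
  ; hub-two = centre , centre-rdf , refl , ≤-refl
  ; witness = witness
  }
  where
  leaf₀ : ∀ {u} → Adj cherry 0F u → u ≡ 2F
  leaf₀ {2F} _ = refl
  leaf₁ : ∀ {u} → Adj cherry 1F u → u ≡ 2F
  leaf₁ {2F} _ = refl

  centre leaves : Fin 3 → Fin 3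
  centre = λ { 2F → 2F ; _ → 0F }
  leaves = λ { 2F → 0F ; _ → 1F }

  centre-rdf : IsRDF cherry centre
  centre-rdf 0F _ = 2F , refl , refl
  centre-rdf 1F _ = 2F , refl , refl
  centre-rdf 2F ()

  leaves-rdf : IsRDFExcept cherry hub leaves
  leaves-rdf 2F 2≢2 = contradiction refl 2≢2

  witness : ∀ v → ∃[ f ] (IsRDFExcept cherry hub f × toℕ (f v) ≢ 0 × weight f ≤ 2)
  witness 0F = leaves , leaves-rdf , (λ ()) , ≤-refl
  witness 1F = leaves , leaves-rdf , (λ ()) , ≤-refl
  witness 2F = centre , rdf⇒rdfExcept {G = cherry} centre-rdf , (λ ()) , ≤-refl

P₄ : Graph 4
P₄ = pathGraph 4

P₅ : Graph 5
P₅ = pathGraph 5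

path-start : ∀ {n u} → Adj (pathGraph (2 + n)) 0F u → u ≡ 1F
path-start {u = 1F} _ = refl

path-second : ∀ {n u} → Adj (pathGraph (3 + n)) 1F u → u ≡ 0F ⊎ u ≡ 2F
path-second {u = 0F} _ = inj₁ refl
path-second {u = 2F} _ = inj₂ refl

P₄-lower-bound : ∀ f → IsRDFExcept P₄ hub f → 3 ≤ weight f
P₄-lower-bound f rdf = begin
  3                                               ≤⟨ legs-bound (f 2F) first-leg last-leg ⟩
  toℕ (f 0F) + toℕ (f 1F) + toℕ (f 3F) + toℕ (f 2F)
    ≡⟨ rearrange (toℕ (f 0F)) (toℕ (f 1F)) (toℕ (f 2F)) (toℕ (f 3F)) ⟩
  weight f                                        ∎
  where
  open ≤-Reasoning
  rearrange : ∀ a b c d → a + b + d + c ≡ a + (b + (c + (d + 0)))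
  rearrange = solve-∀
  end : ∀ {u} → Adj P₄ 3F u → u ≡ 2F
  end {2F} _ = refl
  end {3F} ()
  first-leg : 2 ≤ toℕ (f 0F) + toℕ (f 1F) + δ₂ (f 2F)
  first-leg = pendant-pair-bound (f 0F) (f 1F) (f 2F)
    (sole-neighbour-two P₄ path-start (rdf 0F λ ())) (one-of-neighbours-two P₄ path-second (rdf 1F λ ()))
  last-leg : 1 ≤ toℕ (f 3F) + δ₂ (f 2F)
  last-leg = leaf-bound (f 3F) (f 2F) (sole-neighbour-two P₄ end (rdf 3F λ ()))

P₄-hubbed P₄-inner : Fin 4 → Fin 3
P₄-hubbed = λ { 0F → 1F ; 2F → 2F ; _ → 0F }
P₄-inner = λ { 1F → 2F ; 3F → 1F ; _ → 0F }

P₄-hubbed-rdf : IsRDF P₄ P₄-hubbed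
P₄-hubbed-rdf 1F _ = 2F , refl , refl
P₄-hubbed-rdf 3F _ = 2F , refl , refl

P₄-inner-rdf : IsRDF P₄ P₄-inner
P₄-inner-rdf 0F _ = 1F , refl , refl
P₄-inner-rdf 2F _ = 1F , refl , refl
P₄-inner-rdf 3F ()

P₄-witness : ∀ v → ExcellenceWitness P₄ 3 v
P₄-witness 0F = P₄-hubbed , P₄-hubbed-rdf , (λ ()) , ≤-refl
P₄-witness 1F = P₄-inner , P₄-inner-rdf , (λ ()) , ≤-refl
P₄-witness 2F = P₄-hubbed , P₄-hubbed-rdf , (λ ()) , ≤-refl
P₄-witness 3F = P₄-inner , P₄-inner-rdf , (λ ()) , ≤-refl

P₄-hubExcellent : HubExcellent P₄ 3
P₄-hubExcellent = record
  { lower-bound = P₄-lower-bound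
  ; hub-two = P₄-hubbed , P₄-hubbed-rdf , refl , ≤-refl
  ; witness = relax {G = P₄} ∘ P₄-witness
  }

P₄-excellent : γR-Excellent P₄
P₄-excellent = excellent-from-witnesses P₄ (λ f → P₄-lower-bound f ∘ rdf⇒rdfExcept {G = P₄}) P₄-witness

P₅-lower-bound : ∀ f → IsRDFExcept P₅ hub f → 4 ≤ weight f
P₅-lower-bound f rdf = begin
  4                                                   ≤⟨ legs-bound (f 2F) first-leg last-leg ⟩
  toℕ (f 0F) + toℕ (f 1F) + (toℕ (f 4F) + toℕ (f 3F)) + toℕ (f 2F)
    ≡⟨ rearrange (toℕ (f 0F)) (toℕ (f 1F)) (toℕ (f 2F)) (toℕ (f 3F)) (toℕ (f 4F)) ⟩
  weight f                                            ∎
  where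
  open ≤-Reasoning
  rearrange : ∀ a b c d e → a + b + (e + d) + c ≡ a + (b + (c + (d + (e + 0))))
  rearrange = solve-∀
  fourth : ∀ {u} → Adj P₅ 3F u → u ≡ 2F ⊎ u ≡ 4F
  fourth {2F} _ = inj₁ refl
  fourth {4F} _ = inj₂ refl
  fourth {3F} ()
  end : ∀ {u} → Adj P₅ 4F u → u ≡ 3F
  end {3F} _ = refl
  end {4F} ()
  first-leg : 2 ≤ toℕ (f 0F) + toℕ (f 1F) + δ₂ (f 2F)
  first-leg = pendant-pair-bound (f 0F) (f 1F) (f 2F)
    (sole-neighbour-two P₅ path-start (rdf 0F λ ())) (one-of-neighbours-two P₅ path-second (rdf 1F λ ()))
  last-leg : 2 ≤ toℕ (f 4F) + toℕ (f 3F) + δ₂ (f 2F)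
  last-leg = pendant-pair-bound (f 4F) (f 3F) (f 2F)
    (sole-neighbour-two P₅ end (rdf 4F λ ())) (swap ∘ one-of-neighbours-two P₅ fourth (rdf 3F λ ()))

P₅-hubbed P₅-inner : Fin 5 → Fin 3
P₅-hubbed = λ { 0F → 1F ; 2F → 2F ; 4F → 1F ; _ → 0F }
P₅-inner = λ { 1F → 2F ; 3F → 2F ; _ → 0F }

P₅-hubbed-rdf : IsRDF P₅ P₅-hubbed
P₅-hubbed-rdf 1F _ = 2F , refl , refl
P₅-hubbed-rdf 3F _ = 2F , refl , refl
P₅-hubbed-rdf 4F ()

P₅-inner-rdf : IsRDF P₅ P₅-inner
P₅-inner-rdf 0F _ = 1F , refl , refl
P₅-inner-rdf 2F _ = 1F , refl , refl
P₅-inner-rdf 4F _ = 3F , refl , refl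

P₅-witness : ∀ v → ExcellenceWitness P₅ 4 v
P₅-witness 0F = P₅-hubbed , P₅-hubbed-rdf , (λ ()) , ≤-refl
P₅-witness 1F = P₅-inner , P₅-inner-rdf , (λ ()) , ≤-refl
P₅-witness 2F = P₅-hubbed , P₅-hubbed-rdf , (λ ()) , ≤-refl
P₅-witness 3F = P₅-inner , P₅-inner-rdf , (λ ()) , ≤-refl
P₅-witness 4F = P₅-hubbed , P₅-hubbed-rdf , (λ ()) , ≤-refl

P₅-hubExcellent : HubExcellent P₅ 4
P₅-hubExcellent = record
  { lower-bound = P₅-lower-bound
  ; hub-two = P₅-hubbed , P₅-hubbed-rdf , refl , ≤-refl
  ; witness = relax {G = P₅} ∘ P₅-witness
  }

P₅-excellent : γR-Excellent P₅
P₅-excellent = excellent-from-witnesses P₅ (λ f → P₅-lower-bound f ∘ rdf⇒rdfExcept {G = P₅}) P₅-witness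

K₁-excellent : γR-Excellent (pathGraph 1)
K₁-excellent = excellent-from-witnesses (pathGraph 1) lower-bound witness
  where
  witness : ∀ v → ExcellenceWitness (pathGraph 1) 1 v
  witness 0F = (λ _ → 1F) , (λ { 0F () }) , (λ ()) , ≤-refl
  lower-bound : ∀ f → IsRDF (pathGraph 1) f → 1 ≤ weight f
  lower-bound f rdf with f 0F in f0
  ... | suc _ = s≤s z≤n
  ... | 0F with rdf 0F (cong toℕ f0)
  ...   | 0F , () , _

-- K₂ is a pendant pair hanging from nothing, i.e. from a vertex of value 0.
K₂-excellent : γR-Excellent (pathGraph 2)
K₂-excellent = excellent-from-witnesses (pathGraph 2) lower-bound witness
  where
  end : ∀ {u} → Adj (pathGraph 2) 1F u → u ≡ 0F
  end {0F} _ = refl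
  end {1F} ()
  lower-bound : ∀ f → IsRDF (pathGraph 2) f → 2 ≤ weight f
  lower-bound f rdf = ≤-trans
    (pendant-pair-bound (f 0F) (f 1F) 0F (sole-neighbour-two (pathGraph 2) path-start (rdf 0F))
                                        (inj₁ ∘ sole-neighbour-two (pathGraph 2) end (rdf 1F)))
    (≤-reflexive (+-assoc (toℕ (f 0F)) (toℕ (f 1F)) 0))
  witness : ∀ v → ExcellenceWitness (pathGraph 2) 2 v
  witness 0F = (λ { 0F → 2F ; 1F → 0F }) , (λ { 0F () ; 1F _ → 0F , refl , refl }) , (λ ()) , ≤-refl
  witness 1F = (λ { 0F → 0F ; 1F → 2F }) , (λ { 0F _ → 1F , refl , refl ; 1F () }) , (λ ()) , ≤-refl

-- Excellent trees of every order other than 3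

reaches⇒connected : ∀ {n} (G : Graph n) {r} → (∀ v → Star (Adj G) v r) → Connected G
reaches⇒connected G reach u v = reach u ◅◅ reverse (adj-sym G) (reach v)

tree : ∀ t → Graph (4 + t)
tree 0 = P₄
tree 1 = P₅
tree 2 = addCherry cherry
tree (suc (suc (suc t))) = addCherry (tree t)

tree-hubExcellent : ∀ t → ∃ (HubExcellent (tree t))
tree-hubExcellent 0 = 3 , P₄-hubExcellent
tree-hubExcellent 1 = 4 , P₅-hubExcellent
tree-hubExcellent 2 = 4 , addCherry-hubExcellent cherry-hubExcellent
tree-hubExcellent (suc (suc (suc t))) with tree-hubExcellent t
... | w , exc = 2 + w , addCherry-hubExcellent exc

tree-excellent : ∀ t → γR-Excellent (tree t)
tree-excellent 0 = P₄-excellent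
tree-excellent 1 = P₅-excellent
tree-excellent 2 = addCherry-excellent cherry-hubExcellent
tree-excellent (suc (suc (suc t))) = addCherry-excellent (proj₂ (tree-hubExcellent t))

tree-edges : ∀ t → edges (tree t) ≡ 3 + t
tree-edges 0 = refl
tree-edges 1 = refl
tree-edges 2 = addCherry-edges cherry
tree-edges (suc (suc (suc t))) = trans (addCherry-edges (tree t)) (cong (3 +_) (tree-edges t))

tree-reaches-hub : ∀ t v → Star (Adj (tree t)) v hub
tree-reaches-hub 0 = P₄-reaches-hub
  where
  P₄-reaches-hub : ∀ v → Star (Adj P₄) v hub
  P₄-reaches-hub 0F = _◅_ {j = 1F} refl (refl ◅ ε)
  P₄-reaches-hub 1F = refl ◅ ε
  P₄-reaches-hub 2F = ε
  P₄-reaches-hub 3F = refl ◅ ε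
tree-reaches-hub 1 = P₅-reaches-hub
  where
  P₅-reaches-hub : ∀ v → Star (Adj P₅) v hub
  P₅-reaches-hub 0F = _◅_ {j = 1F} refl (refl ◅ ε)
  P₅-reaches-hub 1F = refl ◅ ε
  P₅-reaches-hub 2F = ε
  P₅-reaches-hub 3F = refl ◅ ε
  P₅-reaches-hub 4F = _◅_ {j = 3F} refl (refl ◅ ε)
tree-reaches-hub 2 = addCherry-reaches-hub cherry-reaches-hub
  where
  cherry-reaches-hub : ∀ v → Star (Adj cherry) v hub
  cherry-reaches-hub 0F = refl ◅ ε
  cherry-reaches-hub 1F = refl ◅ ε
  cherry-reaches-hub 2F = ε
tree-reaches-hub (suc (suc (suc t))) = addCherry-reaches-hub (tree-reaches-hub t)

excellent-tree : ∀ n → 1 ≤ n → n ≢ 3 → ∃[ T ] (Connected {n} T × γR-Excellent T × edges T < n)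
excellent-tree 1 _ _ = pathGraph 1 , reaches⇒connected (pathGraph 1) K₁-reaches , K₁-excellent , s≤s z≤n
  where
  K₁-reaches : ∀ v → Star (Adj (pathGraph 1)) v 0F
  K₁-reaches 0F = ε
excellent-tree 2 _ _ = pathGraph 2 , reaches⇒connected (pathGraph 2) K₂-reaches , K₂-excellent , s≤s (s≤s z≤n)
  where
  K₂-reaches : ∀ v → Star (Adj (pathGraph 2)) v 0F
  K₂-reaches 0F = ε
  K₂-reaches 1F = refl ◅ ε
excellent-tree 3 _ n≢3 = contradiction refl n≢3
excellent-tree (suc (suc (suc (suc t)))) _ _ =
  tree t , reaches⇒connected (tree t) (tree-reaches-hub t) , tree-excellent t , ≤-reflexive (cong suc (tree-edges t))

-- Three vertices

first-step : ∀ {A : Set} {R : A → A → Set} {x y} → Star R x y → x ≢ y → ∃ (R x)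
first-step ε x≢x = contradiction refl x≢x
first-step (step ◅ _) _ = _ , step

-- The weight identity depends on how u, v, w enumerate Fin 3, so it is supplied by each instance.
module _ (G : Graph 3) (conn : Connected G) {u v w : Fin 3} (u≢v : u ≢ v) (u≢w : u ≢ w) (v≢w : v ≢ w)
         (cover : ∀ x → x ≡ u ⊎ x ≡ v ⊎ x ≡ w)
         (weight≡ : ∀ f → weight f ≡ toℕ (f u) + toℕ (f v) + toℕ (f w))
         (¬uv : ¬ Adj G u v) where

  private
    neighbour-u : ∀ {x} → Adj G u x → x ≡ w
    neighbour-u {x} ux with cover x
    ... | inj₁ refl = contradiction refl (adj-≢ G ux)
    ... | inj₂ (inj₁ refl) = contradiction ux ¬uv
    ... | inj₂ (inj₂ x≡w) = x≡w

    neighbour-v : ∀ {x} → Adj G v x → x ≡ w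
    neighbour-v {x} vx with cover x
    ... | inj₁ refl = contradiction (adj-sym G vx) ¬uv
    ... | inj₂ (inj₁ refl) = contradiction refl (adj-≢ G vx)
    ... | inj₂ (inj₂ x≡w) = x≡w

    neighbour-w : ∀ {x} → Adj G w x → x ≡ v ⊎ x ≡ u
    neighbour-w {x} wx with cover x
    ... | inj₁ x≡u = inj₂ x≡u
    ... | inj₂ (inj₁ x≡v) = inj₁ x≡v
    ... | inj₂ (inj₂ refl) = contradiction refl (adj-≢ G wx)

    joined-to-w : ∀ {x y} → x ≢ y → (∀ {z} → Adj G x z → z ≡ w) → Adj G x w
    joined-to-w {x} {y} x≢y only with first-step (conn x y) x≢y
    ... | z , xz = subst (Adj G x) (only xz) xz

    centre : Fin 3 → Fin 3
    centre x = if isYes (x ≟ᶠ w) then 2F else 0F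

    centre-elsewhere : ∀ {x} → x ≢ w → toℕ (centre x) ≡ 0
    centre-elsewhere {x} x≢w with x ≟ᶠ w
    ... | yes x≡w = contradiction x≡w x≢w
    ... | no _ = refl

    centre-at-w : toℕ (centre w) ≡ 2
    centre-at-w with w ≟ᶠ w
    ... | yes _ = refl
    ... | no w≢w = contradiction refl w≢w

    centre-rdf : IsRDF G centre
    centre-rdf x centre-x≡0 with cover x
    ... | inj₁ refl = w , joined-to-w u≢v neighbour-u , centre-at-w
    ... | inj₂ (inj₁ refl) = w , joined-to-w (u≢v ∘ sym) neighbour-v , centre-at-w
    ... | inj₂ (inj₂ refl) = contradiction (trans (sym centre-at-w) centre-x≡0) λ ()

    centre-weight : weight centre ≡ 2
    centre-weight = trans (weight≡ centre)
      (cong₂ _+_ (cong₂ _+_ (centre-elsewhere u≢w) (centre-elsewhere v≢w)) centre-at-w)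

  missing-edge⇒¬excellent : ¬ γR-Excellent G
  missing-edge⇒¬excellent excellent with excellent u
  ... | f , (f-rdf , f-minimal) , fu≢0 = n≮n 2 (begin
    3                                   ≤⟨ pendant-pair-at-nonzero-bound (f v) (f w) (f u) fu≢0 dom-v dom-w ⟩
    toℕ (f u) + toℕ (f v) + toℕ (f w)   ≡⟨ weight≡ f ⟨
    weight f                            ≤⟨ f-minimal centre centre-rdf ⟩
    weight centre                       ≡⟨ centre-weight ⟩
    2                                   ∎)
    where
    open ≤-Reasoning
    dom-v = sole-neighbour-two G neighbour-v (f-rdf v)
    dom-w = one-of-neighbours-two G neighbour-w (f-rdf w)

connected-excellent⇒K₃ : (G : Graph 3) → Connected G → γR-Excellent G → IsK3 G
connected-excellent⇒K₃ G conn excellent = refl , adjacent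
  where
  edge-present : ∀ {u v w} → u ≢ v → u ≢ w → v ≢ w → (∀ x → x ≡ u ⊎ x ≡ v ⊎ x ≡ w) →
    (∀ f → weight f ≡ toℕ (f u) + toℕ (f v) + toℕ (f w)) → Adj G u v
  edge-present {u} {v} u≢v u≢w v≢w cover weight≡ = decidable-stable (adj G u v ≟ᵇ true)
    λ ¬uv → missing-edge⇒¬excellent G conn u≢v u≢w v≢w cover weight≡ ¬uv excellent

  sum₀₁₂ : ∀ a b c → a + (b + (c + 0)) ≡ a + b + c
  sum₀₁₂ = solve-∀
  sum₀₂₁ : ∀ a b c → a + (b + (c + 0)) ≡ a + c + b
  sum₀₂₁ = solve-∀
  sum₁₂₀ : ∀ a b c → a + (b + (c + 0)) ≡ b + c + a
  sum₁₂₀ = solve-∀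

  e₀₁ : Adj G 0F 1F
  e₀₁ = edge-present (λ ()) (λ ()) (λ ())
    (λ { 0F → inj₁ refl ; 1F → inj₂ (inj₁ refl) ; 2F → inj₂ (inj₂ refl) })
    (λ f → sum₀₁₂ (toℕ (f 0F)) (toℕ (f 1F)) (toℕ (f 2F)))
  e₀₂ : Adj G 0F 2F
  e₀₂ = edge-present (λ ()) (λ ()) (λ ())
    (λ { 0F → inj₁ refl ; 2F → inj₂ (inj₁ refl) ; 1F → inj₂ (inj₂ refl) })
    (λ f → sum₀₂₁ (toℕ (f 0F)) (toℕ (f 1F)) (toℕ (f 2F)))
  e₁₂ : Adj G 1F 2F
  e₁₂ = edge-present (λ ()) (λ ()) (λ ())
    (λ { 1F → inj₁ refl ; 2F → inj₂ (inj₁ refl) ; 0F → inj₂ (inj₂ refl) })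
    (λ f → sum₁₂₀ (toℕ (f 0F)) (toℕ (f 1F)) (toℕ (f 2F)))

  adjacent : ∀ u v → u ≢ v → Adj G u v
  adjacent 0F 1F _ = e₀₁
  adjacent 0F 2F _ = e₀₂
  adjacent 1F 2F _ = e₁₂
  adjacent 1F 0F _ = adj-sym G e₀₁
  adjacent 2F 0F _ = adj-sym G e₀₂
  adjacent 2F 1F _ = adj-sym G e₁₂
  adjacent 0F 0F 0≢0 = contradiction refl 0≢0
  adjacent 1F 1F 1≢1 = contradiction refl 1≢1
  adjacent 2F 2F 2≢2 = contradiction refl 2≢2

corollary5p3 : (n : ℕ) → 1 ≤ n → (G : Graph n) → Connected G → γR-Excellent G
    → (∀ (H : Graph n) → Connected H → γR-Excellent H → edges G ≤ edges H)
    → IsK3 G ⊎ (n ≢ 3 × IsTree G)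
corollary5p3 n 1≤n G connected excellent minimal with n ≟ℕ 3
... | yes refl = inj₁ (connected-excellent⇒K₃ G connected excellent)
... | no n≢3 = inj₂ (n≢3 , connected , acyclic)
  where
  acyclic : Acyclic G
  acyclic vs cycle with excellent-tree n 1≤n n≢3
  ... | T , T-connected , T-excellent , T-edges<n = n≮n n (begin-strict
    n        ≤⟨ cycle⇒≤edges G connected vs cycle ⟩
    edges G  ≤⟨ minimal T T-connected T-excellent ⟩
    edges T  <⟨ T-edges<n ⟩
    n        ∎)
    where open ≤-Reasoning
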